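{- Let $\mathcal{E}$ be a well-pointed cartesian closed category. Then the full subcategory $\mathcal{E}_{\leq 1}$ of objects having at most one point is a sub-CCC of $\mathcal{E}$ (it contains the terminal object and is closed under the products and exponentials of $\mathcal{E}$). Moreover, the full subcategory $\mathcal{E}_{=1}$ of objects having exactly one point is equivalent to the terminal category.
   Context: A point of an object $c$ is a morphism $1\to c$. A CCC is well-pointed if every morphism is determined by its action on points of its domain, i.e. $f,g : a\to b$ with $f\circ x = g\circ x$ for all $x : 1\to a$ satisfy $f=g$. -}

module Defs where

open import Level using (Level; _⊔_; suc; 0ℓ)
open import Data.Product using (Σ; _×_; _,_; proj₁; proj₂)
open import Data.Unit using (⊤; tt)
open import Relation.Binary.PropositionalEquality using (_≡_; refl)

record Category (o ℓ : Level) : Set (suc (o ⊔ ℓ)) where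
  infixr 9 _∘_
  field
    Obj   : Set o
    Hom   : Obj → Obj → Set ℓ
    id    : ∀ {a} → Hom a a
    _∘_   : ∀ {a b c} → Hom b c → Hom a b → Hom a c
    identityˡ : ∀ {a b} (f : Hom a b) → id ∘ f ≡ f
    identityʳ : ∀ {a b} (f : Hom a b) → f ∘ id ≡ f
    assoc     : ∀ {a b c d} (f : Hom c d) (g : Hom b c) (h : Hom a b) →
                (f ∘ g) ∘ h ≡ f ∘ (g ∘ h)

record CCC (o ℓ : Level) : Set (suc (o ⊔ ℓ)) where
  field
    cat : Category o ℓ
  open Category cat public
  infixr 7 _×ₒ_
  field
    𝟙     : Obj
    !     : ∀ {a} → Hom a 𝟙
    !-unique : ∀ {a} (f : Hom a 𝟙) → f ≡ !
    _×ₒ_  : Obj → Obj → Obj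
    π₁    : ∀ {a b} → Hom (a ×ₒ b) a
    π₂    : ∀ {a b} → Hom (a ×ₒ b) b
    ⟨_,_⟩ : ∀ {c a b} → Hom c a → Hom c b → Hom c (a ×ₒ b)
    π₁-β  : ∀ {c a b} (f : Hom c a) (g : Hom c b) → π₁ ∘ ⟨ f , g ⟩ ≡ f
    π₂-β  : ∀ {c a b} (f : Hom c a) (g : Hom c b) → π₂ ∘ ⟨ f , g ⟩ ≡ g
    ⟨⟩-unique : ∀ {c a b} (f : Hom c a) (g : Hom c b) (h : Hom c (a ×ₒ b)) →
                π₁ ∘ h ≡ f → π₂ ∘ h ≡ g → h ≡ ⟨ f , g ⟩
    -- exponentials:  exp a b  is  b^a
    exp   : Obj → Obj → Obj
    eval  : ∀ {a b} → Hom (exp a b ×ₒ a) b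
    curry : ∀ {c a b} → Hom (c ×ₒ a) b → Hom c (exp a b)
    curry-β : ∀ {c a b} (f : Hom (c ×ₒ a) b) →
              eval ∘ ⟨ curry f ∘ π₁ , π₂ ⟩ ≡ f
    curry-unique : ∀ {c a b} (f : Hom (c ×ₒ a) b) (h : Hom c (exp a b)) →
                   eval ∘ ⟨ h ∘ π₁ , π₂ ⟩ ≡ f → h ≡ curry f

  Point : Obj → Set ℓ
  Point a = Hom 𝟙 a

  WellPointed : Set (o ⊔ ℓ)
  WellPointed = ∀ {a b} (f g : Hom a b) → (∀ (x : Point a) → f ∘ x ≡ g ∘ x) → f ≡ g

  AtMostOnePoint : Obj → Set ℓ
  AtMostOnePoint a = (x y : Point a) → x ≡ y

  ExactlyOnePoint : Obj → Set ℓ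
  ExactlyOnePoint a = Σ (Point a) (λ x → (y : Point a) → y ≡ x)

FullSub : ∀ {o ℓ p} (C : Category o ℓ) → (Category.Obj C → Set p) → Category (o ⊔ p) ℓ
FullSub C P = record
  { Obj = Σ Obj P
  ; Hom = λ a b → Hom (proj₁ a) (proj₁ b)
  ; id = id
  ; _∘_ = _∘_
  ; identityˡ = identityˡ
  ; identityʳ = identityʳ
  ; assoc = assoc
  }
  where open Category C

TerminalCat : Category 0ℓ 0ℓ
TerminalCat = record
  { Obj = ⊤ ; Hom = λ _ _ → ⊤ ; id = tt ; _∘_ = λ _ _ → tt
  ; identityˡ = λ _ → refl ; identityʳ = λ _ → refl ; assoc = λ _ _ _ → refl }

record Functor {o ℓ o′ ℓ′} (C : Category o ℓ) (D : Category o′ ℓ′)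
       : Set (o ⊔ ℓ ⊔ o′ ⊔ ℓ′) where
  private
    module C = Category C
    module D = Category D
  field
    F₀ : C.Obj → D.Obj
    F₁ : ∀ {a b} → C.Hom a b → D.Hom (F₀ a) (F₀ b)
    F-id : ∀ {a} → F₁ (C.id {a}) ≡ D.id
    F-∘  : ∀ {a b c} (f : C.Hom b c) (g : C.Hom a b) → F₁ (f C.∘ g) ≡ F₁ f D.∘ F₁ g

IdF : ∀ {o ℓ} (C : Category o ℓ) → Functor C C
IdF C = record { F₀ = λ a → a ; F₁ = λ f → f ; F-id = refl ; F-∘ = λ _ _ → refl }

_∘F_ : ∀ {o ℓ o′ ℓ′ o″ ℓ″} {C : Category o ℓ} {D : Category o′ ℓ′} {E : Category o″ ℓ″} →
       Functor D E → Functor C D → Functor C E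
_∘F_ {E = E} G F = record
  { F₀ = λ a → G.F₀ (F.F₀ a)
  ; F₁ = λ f → G.F₁ (F.F₁ f)
  ; F-id = trans′ (cong′ G.F₁ F.F-id) G.F-id
  ; F-∘ = λ f g → trans′ (cong′ G.F₁ (F.F-∘ f g)) (G.F-∘ (F.F₁ f) (F.F₁ g))
  }
  where
    module F = Functor F
    module G = Functor G
    trans′ : ∀ {a} {A : Set a} {x y z : A} → x ≡ y → y ≡ z → x ≡ z
    trans′ refl q = q
    cong′ : ∀ {a b} {A : Set a} {B : Set b} (f : A → B) {x y : A} → x ≡ y → f x ≡ f y
    cong′ f refl = refl

record NatIso {o ℓ o′ ℓ′} {C : Category o ℓ} {D : Category o′ ℓ′}
       (F G : Functor C D) : Set (o ⊔ ℓ ⊔ ℓ′) where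
  private
    module C = Category C
    module D = Category D
    module F = Functor F
    module G = Functor G
  field
    η   : ∀ a → D.Hom (F.F₀ a) (G.F₀ a)
    η⁻¹ : ∀ a → D.Hom (G.F₀ a) (F.F₀ a)
    iso₁ : ∀ a → η⁻¹ a D.∘ η a ≡ D.id
    iso₂ : ∀ a → η a D.∘ η⁻¹ a ≡ D.id
    natural : ∀ {a b} (f : C.Hom a b) → η b D.∘ F.F₁ f ≡ G.F₁ f D.∘ η a

record Equivalence {o ℓ o′ ℓ′} (C : Category o ℓ) (D : Category o′ ℓ′)
       : Set (o ⊔ ℓ ⊔ o′ ⊔ ℓ′) where
  field
    F : Functor C D
    G : Functor D C
    GF≅id : NatIso (G ∘F F) (IdF C)
    FG≅id : NatIso (F ∘F G) (IdF D)

module _ {o ℓ} (E : CCC o ℓ) where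
  open CCC E

  E≤1 : Category (o ⊔ ℓ) ℓ
  E≤1 = FullSub cat AtMostOnePoint

  E=1 : Category (o ⊔ ℓ) ℓ
  E=1 = FullSub cat ExactlyOnePoint

{-# OPTIONS --safe #-}
-- Points of 𝟙 and of a × b are determined by their (unique) components, so these
-- objects have at most one point without any hypothesis.  In a well-pointed category
-- an object b with at most one point is subterminal: two maps into b agree on all
-- points, hence are equal.  A point of bᵃ is determined by its uncurrying 𝟙 × a → b,
-- so bᵃ has at most one point as soon as b does.  An object with exactly one point x
-- is isomorphic to 𝟙 via x and !, and all hom-sets between such objects are
-- singletons, which makes E=1 equivalent to the terminal category.
module Submission where

open import Data.Product using (_×_; _,_; proj₁; proj₂)
open import Data.Unit using (tt)
open import Relation.Binary.PropositionalEquality using (_≡_; refl; sym; trans; cong; module ≡-Reasoning)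
open import Defs

module PointsOfCCC {o ℓ} (E : CCC o ℓ) where
  open CCC E

  𝟙-atMostOnePoint : AtMostOnePoint 𝟙
  𝟙-atMostOnePoint x y = trans (!-unique x) (sym (!-unique y))

  ×-atMostOnePoint : ∀ {a b} → AtMostOnePoint a → AtMostOnePoint b → AtMostOnePoint (a ×ₒ b)
  ×-atMostOnePoint ha hb p q =
    trans (⟨⟩-unique (π₁ ∘ q) (π₂ ∘ q) p (ha _ _) (hb _ _))
          (sym (⟨⟩-unique (π₁ ∘ q) (π₂ ∘ q) q refl refl))

  uncurry : ∀ {c a b} → Hom c (exp a b) → Hom (c ×ₒ a) b
  uncurry h = eval ∘ ⟨ h ∘ π₁ , π₂ ⟩

  uncurry-injective : ∀ {c a b} (h k : Hom c (exp a b)) → uncurry h ≡ uncurry k → h ≡ k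
  uncurry-injective h k eq =
    trans (curry-unique (uncurry k) h eq) (sym (curry-unique (uncurry k) k refl))

  exactlyOnePoint⇒atMostOnePoint : ∀ {a} → ExactlyOnePoint a → AtMostOnePoint a
  exactlyOnePoint⇒atMostOnePoint (x , unique) y z = trans (unique y) (sym (unique z))

  module WellPointedness (wp : WellPointed) where

    atMostOnePoint⇒subterminal : ∀ {a b} → AtMostOnePoint b → (f g : Hom a b) → f ≡ g
    atMostOnePoint⇒subterminal hb f g = wp f g (λ x → hb (f ∘ x) (g ∘ x))

    exp-atMostOnePoint : ∀ {a b} → AtMostOnePoint b → AtMostOnePoint (exp a b)
    exp-atMostOnePoint hb p q =
      uncurry-injective p q (atMostOnePoint⇒subterminal hb (uncurry p) (uncurry q))

    point∘!≡id : ∀ {a} (h : ExactlyOnePoint a) → proj₁ h ∘ ! ≡ id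
    point∘!≡id {a} (x , unique) = wp (x ∘ !) id pointwise
      where
      open ≡-Reasoning
      pointwise : (y : Point a) → (x ∘ !) ∘ y ≡ id ∘ y
      pointwise y = begin
        (x ∘ !) ∘ y  ≡⟨ assoc x ! y ⟩
        x ∘ (! ∘ y)  ≡⟨ cong (x ∘_) (𝟙-atMostOnePoint (! ∘ y) id) ⟩
        x ∘ id       ≡⟨ identityʳ x ⟩
        x            ≡⟨ sym (unique y) ⟩
        y            ≡⟨ sym (identityˡ y) ⟩
        id ∘ y       ∎

    E=1≃TerminalCat : Equivalence (E=1 E) TerminalCat
    E=1≃TerminalCat = record
      { F = collapse
      ; G = pick𝟙
      ; GF≅id = record
        { η = λ a → proj₁ (proj₂ a)
        ; η⁻¹ = λ _ → !
        ; iso₁ = λ _ → 𝟙-atMostOnePoint _ _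
        ; iso₂ = λ a → point∘!≡id (proj₂ a)
        ; natural = λ {_} {b} _ → exactlyOnePoint⇒atMostOnePoint (proj₂ b) _ _
        }
      ; FG≅id = record
        { η = λ _ → tt ; η⁻¹ = λ _ → tt ; iso₁ = λ _ → refl ; iso₂ = λ _ → refl
        ; natural = λ _ → refl }
      }
      where
      collapse : Functor (E=1 E) TerminalCat
      collapse = record { F₀ = λ _ → tt ; F₁ = λ _ → tt ; F-id = refl ; F-∘ = λ _ _ → refl }

      pick𝟙 : Functor TerminalCat (E=1 E)
      pick𝟙 = record
        { F₀ = λ _ → 𝟙 , ! , !-unique
        ; F₁ = λ _ → id
        ; F-id = refl
        ; F-∘ = λ _ _ → sym (identityˡ id)
        }

proposition5p4 : ∀ {o ℓ} (E : CCC o ℓ) → CCC.WellPointed E →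
    (CCC.AtMostOnePoint E (CCC.𝟙 E)
      × (∀ a b → CCC.AtMostOnePoint E a → CCC.AtMostOnePoint E b →
           CCC.AtMostOnePoint E (CCC._×ₒ_ E a b))
      × (∀ a b → CCC.AtMostOnePoint E a → CCC.AtMostOnePoint E b →
           CCC.AtMostOnePoint E (CCC.exp E a b)))
    × Equivalence (E=1 E) TerminalCat
proposition5p4 E wp =
  ( 𝟙-atMostOnePoint
  , (λ _ _ → ×-atMostOnePoint)
  , (λ _ _ _ → exp-atMostOnePoint)
  )
  , E=1≃TerminalCat
  where
  open PointsOfCCC E
  open WellPointedness wp
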